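{- Let $S$ be a 3-SAT instance and $G(S)$ the graph constructed from it as described in the context. Then for every variable $X_i$ of $S$, every connectivity basis of $G(S)$ contains at least two vertices from $\{x_i^1,\ldots,x_i^5\}$.
   Context: All graphs are finite, simple and undirected. For distinct vertices $v,w$, $\kappa(v,w)$ is the maximum number of internally vertex-disjoint $v$–$w$ paths; $\kappa(v,v)=\infty$. A set $W=\{w_1,\ldots,w_k\}$ is resolving if the vectors $[\kappa(v,w_1),\ldots,\kappa(v,w_k)]$, $v\in V(G)$, are pairwise distinct; a connectivity basis is a resolving set of minimum size. Construction: $S$ is a 3-SAT instance with variables $X_1,\ldots,X_n$ and clauses $C_1,\ldots,C_m$ (each clause a disjunction of literals $X_i$ or $\overline{X}_i$); every variable occurs in some clause. For each variable $X_i$ take vertices $x_i^1,\ldots,x_i^5$ with edges $x_i^1x_i^2, x_i^1x_i^3, x_i^1x_i^4, x_i^1x_i^5, x_i^2x_i^3, x_i^2x_i^4, x_i^2x_i^5, x_i^3x_i^4, x_i^3x_i^5$. For each clause $C_j$ take vertices $c_j^1,\ldots,c_j^6$ with edges $c_j^ac_j^b$ for $a\in\{1,2\}$, $b\in\{3,4,5\}$, edges $c_j^3c_j^4, c_j^3c_j^5, c_j^4c_j^5$, and $c_j^6c_j^3, c_j^6c_j^4, c_j^6c_j^5$. If $X_i$ occurs as a positive literal in $C_j$, add edges $c_j^1x_i^1, c_j^2x_i^1, c_j^2x_i^2$; if $X_i$ occurs as a negative literal in $C_j$, add edges $c_j^1x_i^1, c_j^1x_i^2, c_j^2x_i^2$.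 For every pair of distinct clauses $C_j\neq C_k$ add edges $c_j^1c_k^1, c_j^1c_k^2, c_j^2c_k^1, c_j^2c_k^2$. No other edges. The resulting graph is $G(S)$; it is assumed to be connected. -}

module Defs where

open import Data.Nat using (ℕ; suc; _≤_)
open import Data.Fin using (Fin; zero; suc)
open import Data.Vec using (Vec)
open import Data.Vec.Membership.Propositional as VecMem using ()
open import Data.List using (List; []; _∷_; _++_; [_]; length)
open import Data.List.Membership.Propositional using (_∈_)
open import Data.List.Relation.Unary.Unique.Propositional using (Unique)
open import Data.List.Relation.Unary.Linked using (Linked)
open import Data.List.Relation.Binary.Disjoint.Propositional using (Disjoint)
open import Data.Product using (Σ; ∃; _×_; _,_)
open import Data.Sum using (_⊎_)
open import Relation.Nullary using (¬_)
open import Relation.Binary.PropositionalEquality using (_≡_; _≢_)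

data Literal (n : ℕ) : Set where
  pos : Fin n → Literal n
  neg : Fin n → Literal n

record SAT3 : Set where
  field
    nvars    : ℕ
    nclauses : ℕ
    clause   : Fin nclauses → Vec (Literal nvars) 3

open SAT3 public

OccursPos OccursNeg : (S : SAT3) → Fin (nvars S) → Fin (nclauses S) → Set
OccursPos S i j = pos i VecMem.∈ clause S j
OccursNeg S i j = neg i VecMem.∈ clause S j

EveryVarOccurs : SAT3 → Set
EveryVarOccurs S = ∀ i → ∃ λ j → OccursPos S i j ⊎ OccursNeg S i j

-- The graph G(S)
-- Indices are 0-based: (x i k0) is x_i^1, …, (x i k4) is x_i^5;
-- (c j k0) is c_j^1, …, (c j k5) is c_j^6.

pattern k0 = zero
pattern k1 = suc zero
pattern k2 = suc (suc zero)
pattern k3 = suc (suc (suc zero))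
pattern k4 = suc (suc (suc (suc zero)))
pattern k5 = suc (suc (suc (suc (suc zero))))

low : Fin 2 → Fin 6
low zero = k0
low (suc zero) = k1

data Vertex (S : SAT3) : Set where
  x : Fin (nvars S) → Fin 5 → Vertex S
  c : Fin (nclauses S) → Fin 6 → Vertex S

-- The listed edges (each unordered edge listed in at least one orientation).
data Edge (S : SAT3) : Vertex S → Vertex S → Set where
  x12 : ∀ i → Edge S (x i k0) (x i k1)
  x13 : ∀ i → Edge S (x i k0) (x i k2)
  x14 : ∀ i → Edge S (x i k0) (x i k3)
  x15 : ∀ i → Edge S (x i k0) (x i k4)
  x23 : ∀ i → Edge S (x i k1) (x i k2)
  x24 : ∀ i → Edge S (x i k1) (x i k3)
  x25 : ∀ i → Edge S (x i k1) (x i k4)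
  x34 : ∀ i → Edge S (x i k2) (x i k3)
  x35 : ∀ i → Edge S (x i k2) (x i k4)
  c13 : ∀ j → Edge S (c j k0) (c j k2)
  c14 : ∀ j → Edge S (c j k0) (c j k3)
  c15 : ∀ j → Edge S (c j k0) (c j k4)
  c23 : ∀ j → Edge S (c j k1) (c j k2)
  c24 : ∀ j → Edge S (c j k1) (c j k3)
  c25 : ∀ j → Edge S (c j k1) (c j k4)
  c34 : ∀ j → Edge S (c j k2) (c j k3)
  c35 : ∀ j → Edge S (c j k2) (c j k4)
  c45 : ∀ j → Edge S (c j k3) (c j k4)
  c63 : ∀ j → Edge S (c j k5) (c j k2)
  c64 : ∀ j → Edge S (c j k5) (c j k3)
  c65 : ∀ j → Edge S (c j k5) (c j k4)
  p11 : ∀ i j → OccursPos S i j → Edge S (c j k0) (x i k0)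
  p21 : ∀ i j → OccursPos S i j → Edge S (c j k1) (x i k0)
  p22 : ∀ i j → OccursPos S i j → Edge S (c j k1) (x i k1)
  n11 : ∀ i j → OccursNeg S i j → Edge S (c j k0) (x i k0)
  n12 : ∀ i j → OccursNeg S i j → Edge S (c j k0) (x i k1)
  n22 : ∀ i j → OccursNeg S i j → Edge S (c j k1) (x i k1)
  cc : ∀ j k (a b : Fin 2) → j ≢ k →
       Edge S (c j (low a)) (c k (low b))

Adj : (S : SAT3) → Vertex S → Vertex S → Set
Adj S u v = Edge S u v ⊎ Edge S v u

-- `IsPath S u v is`: u ∷ is ++ [ v ] is a u–v path in G(S), i.e. its
-- vertices are pairwise distinct and consecutive vertices are adjacent;
-- `is` is the list of internal vertices.
IsPath : (S : SAT3) → Vertex S → Vertex S → List (Vertex S) → Set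
IsPath S u v is = Unique (u ∷ is ++ [ v ]) × Linked (Adj S) (u ∷ is ++ [ v ])

Connected : SAT3 → Set
Connected S = ∀ (u v : Vertex S) → u ≢ v → ∃ λ is → IsPath S u v is

DisjointPaths : (S : SAT3) → Vertex S → Vertex S → ℕ → Set
DisjointPaths S u v k =
  Σ (Fin k → List (Vertex S)) λ P →
    (∀ a → IsPath S u v (P a)) ×
    (∀ a b → a ≢ b → (P a ≢ P b) × Disjoint (P a) (P b))

data ℕ∞ : Set where
  fin : ℕ → ℕ∞
  ∞   : ℕ∞

data Kappa (S : SAT3) : Vertex S → Vertex S → ℕ∞ → Set where
  κ-refl : ∀ v → Kappa S v v ∞
  κ-max  : ∀ u v k → u ≢ v → DisjointPaths S u v k →
           ¬ DisjointPaths S u v (suc k) → Kappa S u v (fin k)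

-- Resolving sets and connectivity bases
-- A vertex set is a duplicate-free list; its size is its length.

Resolving : (S : SAT3) → List (Vertex S) → Set
Resolving S W =
  ∀ (u u' : Vertex S) → u ≢ u' →
    ∃ λ w → w ∈ W × (∀ r r' → Kappa S u w r → Kappa S u' w r' → r ≢ r')

IsConnectivityBasis : (S : SAT3) → List (Vertex S) → Set
IsConnectivityBasis S W =
  Unique W × Resolving S W ×
  (∀ W' → Unique W' → Resolving S W' → length W ≤ length W')

{-# OPTIONS --safe #-}
-- Only xᵢ k0 and xᵢ k1 (that is, x_i^1 and x_i^2) have neighbours outside the gadget of X_i, and
-- both are adjacent to each inner vertex xᵢ k2, xᵢ k3, xᵢ k4. Disjoint paths from an inner vertex
-- to an outside vertex can therefore be rerouted to start at any other inner vertex, so no outside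
-- vertex resolves two inner vertices. The twins xᵢ k3 and xᵢ k4 have the triangle xᵢ k0 xᵢ k1 xᵢ k2
-- as neighbourhood and κ = 3 to each of its corners, so a resolving set W contains a twin, say
-- xᵢ k3. The pair xᵢ k2, xᵢ k4 must still be resolved, and xᵢ k3 does not do it because
-- κ(xᵢ k2, xᵢ k3) = κ(xᵢ k4, xᵢ k3) = 3; hence W contains a second vertex of the gadget.
module Submission where

open import Defs
open import Data.Empty using (⊥-elim)
open import Data.Fin using (Fin; zero; suc)
import Data.Fin.Properties as Finₚ
open import Data.List using (List; []; _∷_; _++_; [_]; length; lookup; map)
open import Data.List.Properties using (∷-injectiveˡ)
open import Data.List.Membership.Propositional using (_∈_; _∉_)
open import Data.List.Membership.Propositional.Properties using (∈-lookup; ∈-++⁺ʳ)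
open import Data.List.Relation.Binary.Disjoint.Propositional using (Disjoint)
open import Data.List.Relation.Binary.Subset.Propositional using (_⊆_)
open import Data.List.Relation.Unary.All as All using (All; []; _∷_)
import Data.List.Relation.Unary.All.Properties as Allₚ
open import Data.List.Relation.Unary.AllPairs as AllPairs using ([]; _∷_)
open import Data.List.Relation.Unary.Any using (here; there; index)
open import Data.List.Relation.Unary.Any.Properties using (lookup-index)
open import Data.List.Relation.Unary.Linked using (Linked; [-]; _∷_)
open import Data.List.Relation.Unary.Unique.Propositional using (Unique)
import Data.List.Relation.Unary.Unique.Propositional.Properties as Uniqueₚ
open import Data.List.Relation.Unary.Unique.DecPropositional (Finₚ._≟_ {5}) using (unique?)
open import Data.Nat using (ℕ; zero; suc; _≤_)
open import Data.Nat.Properties using (n≮n)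
open import Data.Product using (∃; ∃₂; _×_; _,_; proj₁; proj₂)
open import Data.Sum using (_⊎_; inj₁; inj₂; swap)
open import Data.Unit using (⊤; tt)
open import Function using (_∘_; id)
open import Relation.Nullary using (¬_; yes; no)
open import Relation.Nullary.Decidable using (True; toWitness; ¬?)
open import Relation.Unary using (Decidable)
open import Relation.Binary.PropositionalEquality using (_≡_; _≢_; refl; sym; cong; subst; ≢-sym; module ≡-Reasoning)

¬¬-maximal-below : ∀ {P : ℕ → Set} n → P 0 → ¬ P n → ¬ ¬ ∃ λ k → P k × ¬ P (suc k)
¬¬-maximal-below zero    p₀ ¬pₙ ¬max = ¬pₙ p₀
¬¬-maximal-below (suc n) p₀ ¬pₙ ¬max = ¬¬-maximal-below n p₀ (λ pₙ → ¬max (n , pₙ , ¬pₙ)) ¬max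

module _ {A : Set} where

  injective-into⇒≤length : ∀ {k} {xs : List A} (f : Fin k → A) (f∈ : ∀ α → f α ∈ xs) →
                           (∀ {α β} → f α ≡ f β → α ≡ β) → k ≤ length xs
  injective-into⇒≤length {xs = xs} f f∈ f-injective = Finₚ.injective⇒≤ index-injective
    where
    open ≡-Reasoning
    index-injective : ∀ {α β} → index (f∈ α) ≡ index (f∈ β) → α ≡ β
    index-injective {α} {β} eq = f-injective (begin
      f α                         ≡⟨ lookup-index (f∈ α) ⟩
      lookup xs (index (f∈ α))    ≡⟨ cong (lookup xs) eq ⟩
      lookup xs (index (f∈ β))    ≡⟨ lookup-index (f∈ β) ⟨
      f β                         ∎)

  Unique⇒lookup-injective : ∀ {xs : List A} → Unique xs → ∀ {α β} → lookup xs α ≡ lookup xs β → α ≡ β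
  Unique⇒lookup-injective (_  ∷ _)      {zero}  {zero}  _  = refl
  Unique⇒lookup-injective (y∉ ∷ _)      {zero}  {suc β} eq = ⊥-elim (All.lookup y∉ (∈-lookup β) eq)
  Unique⇒lookup-injective (y∉ ∷ _)      {suc α} {zero}  eq = ⊥-elim (All.lookup y∉ (∈-lookup α) (sym eq))
  Unique⇒lookup-injective (_  ∷ unique) {suc α} {suc β} eq = cong suc (Unique⇒lookup-injective unique eq)

  Unique[xs∷ʳx]⇒x∉xs : ∀ {x : A} xs → Unique (xs ++ [ x ]) → x ∉ xs
  Unique[xs∷ʳx]⇒x∉xs (y ∷ xs) (y∉ ∷ _)     (here refl)  = All.lookup y∉ (∈-++⁺ʳ xs (here refl)) refl
  Unique[xs∷ʳx]⇒x∉xs (y ∷ xs) (_  ∷ unique) (there x∈xs) = Unique[xs∷ʳx]⇒x∉xs xs unique x∈xs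

module Paths (S : SAT3) where

  private
    V : Set
    V = Vertex S

  Separated : List V → List V → Set
  Separated p q = p ≢ q × Disjoint p q

  Distinguishes : V → V → V → Set
  Distinguishes w u u' = ∀ r r' → Kappa S u w r → Kappa S u' w r' → r ≢ r'

  noPaths : ∀ {u v} → DisjointPaths S u v 0
  noPaths = (λ ()) , (λ ()) , (λ ())

  -- Separated paths have distinct probes, so the probes inject the family into N.
  disjointPaths≤ : ∀ {u v k} (N : List V) (probe : List V → V) →
                   (∀ {y l} → probe (y ∷ l) ∈ y ∷ l) →
                   (∀ {l} → IsPath S u v l → probe [] ∉ l × probe l ∈ N) →
                   DisjointPaths S u v k → k ≤ length N
  disjointPaths≤ N probe probe∈ on-path (P , paths , separated) =
    injective-into⇒≤length (probe ∘ P) (proj₂ ∘ on-path ∘ paths) probe-injective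
    where
    probes-differ : ∀ {p q} → Separated p q → probe [] ∉ p → probe [] ∉ q → probe p ≢ probe q
    probes-differ {[]}    {[]}    (p≢q , _) _ _ _ = p≢q refl
    probes-differ {[]}    {_ ∷ _} _ _ e∉q eq = e∉q (subst (_∈ _) (sym eq) probe∈)
    probes-differ {_ ∷ _} {[]}    _ e∉p _ eq = e∉p (subst (_∈ _) eq probe∈)
    probes-differ {_ ∷ _} {_ ∷ _} (_ , disjoint) _ _ eq = disjoint (probe∈ , subst (_∈ _) (sym eq) probe∈)

    probe-injective : ∀ {α β} → probe (P α) ≡ probe (P β) → α ≡ β
    probe-injective {α} {β} eq with α Finₚ.≟ β
    ... | yes α≡β = α≡β
    ... | no  α≢β = ⊥-elim (probes-differ (separated α β α≢β)
                              (proj₁ (on-path (paths α))) (proj₁ (on-path (paths β))) eq)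

  firstStep : V → List V → V
  firstStep v []      = v
  firstStep _ (y ∷ _) = y

  lastStep : V → List V → V
  lastStep u []      = u
  lastStep _ (y ∷ l) = lastStep y l

  firstStep-adj : ∀ {u v} l → Linked (Adj S) (u ∷ l ++ [ v ]) → Adj S u (firstStep v l)
  firstStep-adj []      (adj ∷ _) = adj
  firstStep-adj (_ ∷ _) (adj ∷ _) = adj

  firstStep-all : ∀ {P : V → Set} {v l} → All P l → P v → P (firstStep v l)
  firstStep-all []       pv = pv
  firstStep-all (py ∷ _) _  = py

  lastStep-adj : ∀ {u v} l → Linked (Adj S) (u ∷ l ++ [ v ]) → Adj S (lastStep u l) v
  lastStep-adj []      (adj ∷ _)    = adj
  lastStep-adj (_ ∷ l) (_ ∷ linked) = lastStep-adj l linked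

  lastStep∈ : ∀ {u y l} → lastStep u (y ∷ l) ∈ y ∷ l
  lastStep∈         {l = []}    = here refl
  lastStep∈ {y = y} {l = _ ∷ _} = there (lastStep∈ {u = y})

  disjointPaths≤sourceDegree : ∀ {u v k} (N : List V) → (∀ {y} → Adj S u y → y ∈ N) →
                               DisjointPaths S u v k → k ≤ length N
  disjointPaths≤sourceDegree {v = v} N neighbours = disjointPaths≤ N (firstStep v) (here refl)
    λ { {l} (_ ∷ unique , linked) → Unique[xs∷ʳx]⇒x∉xs l unique , neighbours (firstStep-adj l linked) }

  disjointPaths≤targetDegree : ∀ {u v k} (N : List V) → (∀ {y} → Adj S y v → y ∈ N) →
                               DisjointPaths S u v k → k ≤ length N
  disjointPaths≤targetDegree {u = u} N neighbours = disjointPaths≤ N (lastStep u) (lastStep∈ {u = u})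
    λ { {l} (u∉ ∷ _ , linked) → Allₚ.All¬⇒¬Any (Allₚ.++⁻ˡ l u∉) , neighbours (lastStep-adj l linked) }

  kappa-by-sourceDegree : ∀ {u v} (N : List V) → (∀ {y} → Adj S u y → y ∈ N) → u ≢ v →
                          DisjointPaths S u v (length N) → Kappa S u v (fin (length N))
  kappa-by-sourceDegree N neighbours u≢v paths =
    κ-max _ _ _ u≢v paths (n≮n _ ∘ disjointPaths≤sourceDegree N neighbours)

  kappa-by-targetDegree : ∀ {u v} (N : List V) → (∀ {y} → Adj S y v → y ∈ N) → u ≢ v →
                          DisjointPaths S u v (length N) → Kappa S u v (fin (length N))
  kappa-by-targetDegree N neighbours u≢v paths =
    κ-max _ _ _ u≢v paths (n≮n _ ∘ disjointPaths≤targetDegree N neighbours)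

  CommonNeighbour : V → V → V → Set
  CommonNeighbour u v y = Adj S u y × Adj S y v

  viaCommonNeighbours : ∀ {u v ys} → Unique (u ∷ v ∷ ys) → All (CommonNeighbour u v) ys →
                        DisjointPaths S u v (length ys)
  viaCommonNeighbours {u} {v} {ys} unique common = (λ α → [ lookup ys α ]) , path , separated
    where
    u∉ : All (u ≢_) (v ∷ ys)
    u∉ = AllPairs.head unique
    v∉ : All (v ≢_) ys
    v∉ = AllPairs.head (AllPairs.tail unique)

    path : ∀ α → IsPath S u v [ lookup ys α ]
    path α = ((All.lookup u∉ (there (∈-lookup α)) ∷ All.head u∉ ∷ [])
              ∷ (≢-sym (All.lookup v∉ (∈-lookup α)) ∷ []) ∷ [] ∷ [])
           , (proj₁ common-α ∷ proj₂ common-α ∷ [-])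
      where
      common-α : CommonNeighbour u v (lookup ys α)
      common-α = All.lookup common (∈-lookup α)

    separated : ∀ α β → α ≢ β → Separated [ lookup ys α ] [ lookup ys β ]
    separated α β α≢β = ys-α≢ys-β ∘ ∷-injectiveˡ
                      , λ { (here refl , here eq) → ys-α≢ys-β eq ; (there () , _) ; (_ , there ()) }
      where
      ys-α≢ys-β : lookup ys α ≢ lookup ys β
      ys-α≢ys-β = α≢β ∘ Unique⇒lookup-injective (AllPairs.tail (AllPairs.tail unique))

  viaEdgeAndCommonNeighbours : ∀ {u v ys} → Adj S u v → Unique (u ∷ v ∷ ys) →
                               All (CommonNeighbour u v) ys → DisjointPaths S u v (suc (length ys))
  viaEdgeAndCommonNeighbours {u} {v} {ys} adj unique common = P , path , separated
    where
    fan : DisjointPaths S u v (length ys)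
    fan = viaCommonNeighbours unique common

    P : Fin (suc (length ys)) → List V
    P zero    = []
    P (suc α) = proj₁ fan α

    path : ∀ α → IsPath S u v (P α)
    path zero    = ((All.head (AllPairs.head unique) ∷ []) ∷ [] ∷ []) , (adj ∷ [-])
    path (suc α) = proj₁ (proj₂ fan) α

    separated : ∀ α β → α ≢ β → Separated (P α) (P β)
    separated zero    zero    0≢0 = ⊥-elim (0≢0 refl)
    separated zero    (suc _) _   = (λ ()) , λ { (() , _) }
    separated (suc _) zero    _   = (λ ()) , λ { (_ , ()) }
    separated (suc α) (suc β) α≢β = proj₂ (proj₂ fan) α β (α≢β ∘ cong suc)

  -- DisjointPaths is not decidable, so κ(u, w) is only found under ¬¬; that suffices to refute
  -- Distinguishes.
  samePaths⇒¬Distinguishes : ∀ {u u' w} n → u ≢ w → u' ≢ w →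
                             (∀ {k} → DisjointPaths S u w k → DisjointPaths S u' w k) →
                             (∀ {k} → DisjointPaths S u' w k → DisjointPaths S u w k) →
                             ¬ DisjointPaths S u w n → ¬ Distinguishes w u u'
  samePaths⇒¬Distinguishes n u≢w u'≢w to from ¬paths-n distinguishes =
    ¬¬-maximal-below n noPaths ¬paths-n λ { (k , paths , ¬more) →
      distinguishes (fin k) (fin k) (κ-max _ _ k u≢w paths ¬more)
                                    (κ-max _ _ k u'≢w (to paths) (¬more ∘ from)) refl }

  module _ (Out : V → Set) (out? : Decidable Out) {w : V} (w-out : Out w) where

    record ExitSegment (l : List V) : Set where
      field
        exit     : V
        rest     : List V
        exit-in  : ¬ Out exit
        rest-out : All Out rest
        isPath   : IsPath S exit w rest
        ⊆l       : exit ∷ rest ⊆ l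

    exitSegment? : ∀ {z} l → IsPath S z w l → ExitSegment l ⊎ All Out l
    exitSegment? []      _                       = inj₂ []
    exitSegment? (y ∷ l) (_ ∷ unique , _ ∷ linked) with exitSegment? l (unique , linked)
    ... | inj₁ segment =
      inj₁ (record { ExitSegment segment hiding (⊆l) ; ⊆l = there ∘ ExitSegment.⊆l segment })
    ... | inj₂ l-out with out? y
    ...   | yes y-out = inj₂ (y-out ∷ l-out)
    ...   | no  y-in  = inj₁ (record { exit = y ; rest = l ; exit-in = y-in ; rest-out = l-out
                                     ; isPath = unique , linked ; ⊆l = id })

    -- An a–w path leaves the complement of Out for the last time at an exit vertex; when b is
    -- adjacent to every exit, starting from b at that exit gives a b–w path inside the old one.
    transferPaths : ∀ {a b k} → (∀ {t} → Adj S a t → ¬ Out t) → ¬ Out b →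
                    (∀ {y t} → ¬ Out y → Adj S y t → Out t → y ≢ b × Adj S b y) →
                    DisjointPaths S a w k → DisjointPaths S b w k
    transferPaths {a} {b} {k} a-sealed b-in exit-attached (P , paths , separated) =
      P' , paths' , separated'
      where
      segment : ∀ α → ExitSegment (P α)
      segment α with exitSegment? (P α) (paths α)
      ... | inj₁ seg   = seg
      ... | inj₂ P-out =
        ⊥-elim (a-sealed (firstStep-adj (P α) (proj₂ (paths α))) (firstStep-all P-out w-out))

      module Seg α = ExitSegment (segment α)

      P' : Fin k → List V
      P' α = Seg.exit α ∷ Seg.rest α

      paths' : ∀ α → IsPath S b w (P' α)
      paths' α = (b∉ ∷ proj₁ (Seg.isPath α)) , (proj₂ attached ∷ proj₂ (Seg.isPath α))
        where
        attached : Seg.exit α ≢ b × Adj S b (Seg.exit α)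
        attached = exit-attached (Seg.exit-in α) (firstStep-adj (Seg.rest α) (proj₂ (Seg.isPath α)))
                                 (firstStep-all (Seg.rest-out α) w-out)
        b∉ : All (b ≢_) (Seg.exit α ∷ Seg.rest α ++ [ w ])
        b∉ = ≢-sym (proj₁ attached)
           ∷ All.map (λ t-out b≡t → b-in (subst Out (sym b≡t) t-out))
                     (Allₚ.++⁺ (Seg.rest-out α) (w-out ∷ []))

      separated' : ∀ α β → α ≢ β → Separated (P' α) (P' β)
      separated' α β α≢β =
          (λ eq → disjoint (Seg.⊆l α (here refl) , Seg.⊆l β (subst (Seg.exit α ∈_) eq (here refl))))
        , λ { (t∈α , t∈β) → disjoint (Seg.⊆l α t∈α , Seg.⊆l β t∈β) }
        where
        disjoint : Disjoint (P α) (P β)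
        disjoint = proj₂ (separated α β α≢β)

variableEdge⇒sameVariable : ∀ {S i j a b} → Edge S (x i a) (x j b) → i ≡ j
variableEdge⇒sameVariable (x12 _) = refl
variableEdge⇒sameVariable (x13 _) = refl
variableEdge⇒sameVariable (x14 _) = refl
variableEdge⇒sameVariable (x15 _) = refl
variableEdge⇒sameVariable (x23 _) = refl
variableEdge⇒sameVariable (x24 _) = refl
variableEdge⇒sameVariable (x25 _) = refl
variableEdge⇒sameVariable (x34 _) = refl
variableEdge⇒sameVariable (x35 _) = refl

module Gadget (S : SAT3) (i : Fin (nvars S)) where

  open Paths S

  xᵢ : Fin 5 → Vertex S
  xᵢ = x i

  Outside : Vertex S → Set
  Outside (x j _) = j ≢ i
  Outside (c _ _) = ⊤

  outside? : Decidable Outside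
  outside? (x j _) = ¬? (j Finₚ.≟ i)
  outside? (c _ _) = yes tt

  ¬Outside⇒inGadget : ∀ {y} → ¬ Outside y → ∃ λ a → y ≡ xᵢ a
  ¬Outside⇒inGadget {x j a} y-in with j Finₚ.≟ i
  ... | yes refl = a , refl
  ... | no  j≢i  = ⊥-elim (y-in j≢i)
  ¬Outside⇒inGadget {c _ _} y-in = ⊥-elim (y-in tt)

  Outside⇒≢ : ∀ {a w} → Outside w → xᵢ a ≢ w
  Outside⇒≢ w-out refl = w-out refl

  x-injective : ∀ {a b} → xᵢ a ≡ xᵢ b → a ≡ b
  x-injective refl = refl

  data Attachment : Fin 5 → Set where
    attachment₀ : Attachment k0
    attachment₁ : Attachment k1

  outsideNeighbour⇒Attachment : ∀ {a t} → Adj S (xᵢ a) t → Outside t → Attachment a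
  outsideNeighbour⇒Attachment {t = x _ _} (inj₁ e) t-out =
    ⊥-elim (t-out (sym (variableEdge⇒sameVariable e)))
  outsideNeighbour⇒Attachment {t = x _ _} (inj₂ e) t-out =
    ⊥-elim (t-out (variableEdge⇒sameVariable e))
  outsideNeighbour⇒Attachment (inj₂ (p11 _ _ _)) _ = attachment₀
  outsideNeighbour⇒Attachment (inj₂ (p21 _ _ _)) _ = attachment₀
  outsideNeighbour⇒Attachment (inj₂ (p22 _ _ _)) _ = attachment₁
  outsideNeighbour⇒Attachment (inj₂ (n11 _ _ _)) _ = attachment₀
  outsideNeighbour⇒Attachment (inj₂ (n12 _ _ _)) _ = attachment₁
  outsideNeighbour⇒Attachment (inj₂ (n22 _ _ _)) _ = attachment₁

  data Inner : Fin 5 → Set where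
    inner₂ : Inner k2
    inner₃ : Inner k3
    inner₄ : Inner k4

  Inner⇒¬Attachment : ∀ {a} → Inner a → ¬ Attachment a
  Inner⇒¬Attachment inner₂ ()
  Inner⇒¬Attachment inner₃ ()
  Inner⇒¬Attachment inner₄ ()

  Inner-adj-Attachment : ∀ {a b} → Inner a → Attachment b → xᵢ b ≢ xᵢ a × Adj S (xᵢ a) (xᵢ b)
  Inner-adj-Attachment inner₂ attachment₀ = (λ ()) , inj₂ (x13 i)
  Inner-adj-Attachment inner₂ attachment₁ = (λ ()) , inj₂ (x23 i)
  Inner-adj-Attachment inner₃ attachment₀ = (λ ()) , inj₂ (x14 i)
  Inner-adj-Attachment inner₃ attachment₁ = (λ ()) , inj₂ (x24 i)
  Inner-adj-Attachment inner₄ attachment₀ = (λ ()) , inj₂ (x15 i)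
  Inner-adj-Attachment inner₄ attachment₁ = (λ ()) , inj₂ (x25 i)

  transferInnerPaths : ∀ {a b w k} → Inner a → Inner b → Outside w →
                       DisjointPaths S (xᵢ a) w k → DisjointPaths S (xᵢ b) w k
  transferInnerPaths {b = b} a-inner b-inner w-out =
    transferPaths Outside outside? w-out
      (λ adj t-out → Inner⇒¬Attachment a-inner (outsideNeighbour⇒Attachment adj t-out))
      (λ b-out → b-out refl)
      exit-attached
    where
    exit-attached : ∀ {y t} → ¬ Outside y → Adj S y t → Outside t → y ≢ xᵢ b × Adj S (xᵢ b) y
    exit-attached y-in adj t-out with ¬Outside⇒inGadget y-in
    ... | _ , refl = Inner-adj-Attachment b-inner (outsideNeighbour⇒Attachment adj t-out)

  corners : List (Vertex S)
  corners = xᵢ k0 ∷ xᵢ k1 ∷ xᵢ k2 ∷ []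

  data Twin : Fin 5 → Set where
    twin₃ : Twin k3
    twin₄ : Twin k4

  Twin-neighbours : ∀ {a y} → Twin a → Adj S (xᵢ a) y → y ∈ corners
  Twin-neighbours twin₃ (inj₂ (x14 _)) = here refl
  Twin-neighbours twin₃ (inj₂ (x24 _)) = there (here refl)
  Twin-neighbours twin₃ (inj₂ (x34 _)) = there (there (here refl))
  Twin-neighbours twin₄ (inj₂ (x15 _)) = here refl
  Twin-neighbours twin₄ (inj₂ (x25 _)) = there (here refl)
  Twin-neighbours twin₄ (inj₂ (x35 _)) = there (there (here refl))

  Outside-¬Distinguishes-Inner : ∀ {a b w} → Outside w → Inner a → Inner b →
                                 ¬ Distinguishes w (xᵢ a) (xᵢ b)
  Outside-¬Distinguishes-Inner w-out a-inner b-inner =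
    samePaths⇒¬Distinguishes 4 (Outside⇒≢ w-out) (Outside⇒≢ w-out)
      (transferInnerPaths a-inner b-inner w-out) (transferInnerPaths b-inner a-inner w-out)
      (n≮n 3 ∘ disjointPaths≤sourceDegree corners (Twin-neighbours twin₃)
             ∘ transferInnerPaths a-inner inner₃ w-out)

  distinguisher-in-gadget : ∀ {W a b} → Resolving S W → Inner a → Inner b → a ≢ b →
                            ∃ λ d → xᵢ d ∈ W × Distinguishes (xᵢ d) (xᵢ a) (xᵢ b)
  distinguisher-in-gadget resolving a-inner b-inner a≢b with resolving _ _ (a≢b ∘ x-injective)
  ... | w , w∈W , distinguishes with outside? w
  ...   | yes w-out = ⊥-elim (Outside-¬Distinguishes-Inner w-out a-inner b-inner distinguishes)
  ...   | no  w-in with ¬Outside⇒inGadget w-in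
  ...     | d , refl = d , w∈W , distinguishes

  distinct : (as : List (Fin 5)) → {True (unique? as)} → Unique (map xᵢ as)
  distinct _ {as-distinct} = Uniqueₚ.map⁺ x-injective (toWitness as-distinct)

  data Corner : Fin 5 → Set where
    corner₀ : Corner k0
    corner₁ : Corner k1
    corner₂ : Corner k2

  κ-Twin-Corner : ∀ {a d} → Twin a → Corner d → Kappa S (xᵢ a) (xᵢ d) (fin 3)
  κ-Twin-Corner twin₃ corner₀ = kappa-by-sourceDegree corners (Twin-neighbours twin₃) (λ ())
    (viaEdgeAndCommonNeighbours (inj₂ (x14 i)) (distinct (k3 ∷ k0 ∷ k1 ∷ k2 ∷ []))
      ((inj₂ (x24 i) , inj₂ (x12 i)) ∷ (inj₂ (x34 i) , inj₂ (x13 i)) ∷ []))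
  κ-Twin-Corner twin₃ corner₁ = kappa-by-sourceDegree corners (Twin-neighbours twin₃) (λ ())
    (viaEdgeAndCommonNeighbours (inj₂ (x24 i)) (distinct (k3 ∷ k1 ∷ k0 ∷ k2 ∷ []))
      ((inj₂ (x14 i) , inj₁ (x12 i)) ∷ (inj₂ (x34 i) , inj₂ (x23 i)) ∷ []))
  κ-Twin-Corner twin₃ corner₂ = kappa-by-sourceDegree corners (Twin-neighbours twin₃) (λ ())
    (viaEdgeAndCommonNeighbours (inj₂ (x34 i)) (distinct (k3 ∷ k2 ∷ k0 ∷ k1 ∷ []))
      ((inj₂ (x14 i) , inj₁ (x13 i)) ∷ (inj₂ (x24 i) , inj₁ (x23 i)) ∷ []))
  κ-Twin-Corner twin₄ corner₀ = kappa-by-sourceDegree corners (Twin-neighbours twin₄) (λ ())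
    (viaEdgeAndCommonNeighbours (inj₂ (x15 i)) (distinct (k4 ∷ k0 ∷ k1 ∷ k2 ∷ []))
      ((inj₂ (x25 i) , inj₂ (x12 i)) ∷ (inj₂ (x35 i) , inj₂ (x13 i)) ∷ []))
  κ-Twin-Corner twin₄ corner₁ = kappa-by-sourceDegree corners (Twin-neighbours twin₄) (λ ())
    (viaEdgeAndCommonNeighbours (inj₂ (x25 i)) (distinct (k4 ∷ k1 ∷ k0 ∷ k2 ∷ []))
      ((inj₂ (x15 i) , inj₁ (x12 i)) ∷ (inj₂ (x35 i) , inj₂ (x23 i)) ∷ []))
  κ-Twin-Corner twin₄ corner₂ = kappa-by-sourceDegree corners (Twin-neighbours twin₄) (λ ())
    (viaEdgeAndCommonNeighbours (inj₂ (x35 i)) (distinct (k4 ∷ k2 ∷ k0 ∷ k1 ∷ []))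
      ((inj₂ (x15 i) , inj₁ (x13 i)) ∷ (inj₂ (x25 i) , inj₁ (x23 i)) ∷ []))

  sibling : ∀ {a} → Twin a → Fin 5
  sibling twin₃ = k4
  sibling twin₄ = k3

  sibling-Inner : ∀ {a} (t : Twin a) → Inner (sibling t)
  sibling-Inner twin₃ = inner₄
  sibling-Inner twin₄ = inner₃

  κ-k2-Twin : ∀ {a} → Twin a → Kappa S (xᵢ k2) (xᵢ a) (fin 3)
  κ-k2-Twin twin₃ = kappa-by-targetDegree corners (Twin-neighbours twin₃ ∘ swap) (λ ())
    (viaEdgeAndCommonNeighbours (inj₁ (x34 i)) (distinct (k2 ∷ k3 ∷ k0 ∷ k1 ∷ []))
      ((inj₂ (x13 i) , inj₁ (x14 i)) ∷ (inj₂ (x23 i) , inj₁ (x24 i)) ∷ []))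
  κ-k2-Twin twin₄ = kappa-by-targetDegree corners (Twin-neighbours twin₄ ∘ swap) (λ ())
    (viaEdgeAndCommonNeighbours (inj₁ (x35 i)) (distinct (k2 ∷ k4 ∷ k0 ∷ k1 ∷ []))
      ((inj₂ (x13 i) , inj₁ (x15 i)) ∷ (inj₂ (x23 i) , inj₁ (x25 i)) ∷ []))

  κ-sibling-Twin : ∀ {a} (t : Twin a) → Kappa S (xᵢ (sibling t)) (xᵢ a) (fin 3)
  κ-sibling-Twin twin₃ = kappa-by-targetDegree corners (Twin-neighbours twin₃ ∘ swap) (λ ())
    (viaCommonNeighbours (distinct (k4 ∷ k3 ∷ k0 ∷ k1 ∷ k2 ∷ []))
      ((inj₂ (x15 i) , inj₁ (x14 i)) ∷ (inj₂ (x25 i) , inj₁ (x24 i))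
                                     ∷ (inj₂ (x35 i) , inj₁ (x34 i)) ∷ []))
  κ-sibling-Twin twin₄ = kappa-by-targetDegree corners (Twin-neighbours twin₄ ∘ swap) (λ ())
    (viaCommonNeighbours (distinct (k3 ∷ k4 ∷ k0 ∷ k1 ∷ k2 ∷ []))
      ((inj₂ (x14 i) , inj₁ (x15 i)) ∷ (inj₂ (x24 i) , inj₁ (x25 i))
                                     ∷ (inj₂ (x34 i) , inj₁ (x35 i)) ∷ []))

  Corner-¬Distinguishes-Twins : ∀ {d} → Corner d → ¬ Distinguishes (xᵢ d) (xᵢ k3) (xᵢ k4)
  Corner-¬Distinguishes-Twins corner distinguishes =
    distinguishes _ _ (κ-Twin-Corner twin₃ corner) (κ-Twin-Corner twin₄ corner) refl

  Twin-¬Distinguishes-k2-sibling : ∀ {a} (t : Twin a) →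
                                   ¬ Distinguishes (xᵢ a) (xᵢ k2) (xᵢ (sibling t))
  Twin-¬Distinguishes-k2-sibling t distinguishes =
    distinguishes _ _ (κ-k2-Twin t) (κ-sibling-Twin t) refl

  resolving∋Twin : ∀ {W} → Resolving S W → ∃ λ a → Twin a × xᵢ a ∈ W
  resolving∋Twin resolving with distinguisher-in-gadget resolving inner₃ inner₄ (λ ())
  ... | k0 , _   , distinguishes = ⊥-elim (Corner-¬Distinguishes-Twins corner₀ distinguishes)
  ... | k1 , _   , distinguishes = ⊥-elim (Corner-¬Distinguishes-Twins corner₁ distinguishes)
  ... | k2 , _   , distinguishes = ⊥-elim (Corner-¬Distinguishes-Twins corner₂ distinguishes)
  ... | k3 , x∈W , _             = k3 , twin₃ , x∈W
  ... | k4 , x∈W , _             = k4 , twin₄ , x∈W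

  k2≢sibling : ∀ {a} (t : Twin a) → k2 ≢ sibling t
  k2≢sibling twin₃ ()
  k2≢sibling twin₄ ()

  resolving∋≢Twin : ∀ {W a} → Twin a → Resolving S W → ∃ λ d → d ≢ a × xᵢ d ∈ W
  resolving∋≢Twin {a = a} t resolving
    with distinguisher-in-gadget resolving inner₂ (sibling-Inner t) (k2≢sibling t)
  ... | d , d∈W , distinguishes with d Finₚ.≟ a
  ...   | yes refl = ⊥-elim (Twin-¬Distinguishes-k2-sibling t distinguishes)
  ...   | no  d≢a  = d , d≢a , d∈W

lemma4p3 : (S : SAT3) → EveryVarOccurs S → Connected S →
           (W : List (Vertex S)) → IsConnectivityBasis S W →
           (i : Fin (nvars S)) →
           ∃₂ λ (a b : Fin 5) → a ≢ b × x i a ∈ W × x i b ∈ W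
lemma4p3 S _ _ W (_ , resolving , _) i =
  let a , a-twin , a∈W = resolving∋Twin resolving
      b , b≢a    , b∈W = resolving∋≢Twin a-twin resolving
  in  a , b , ≢-sym b≢a , a∈W , b∈W
  where open Gadget S i
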